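{- Let $a,b\ge 1$. For every $s\ge 1$, \[ R_{a+b+s}^{(a,b,0,0)}(x,q)=[a+b]_q!\prod_{i=1}^{s}\big([a]_q+q^{a+i}[b]_q+q^a x[i]_q\big). \]
   Context: $[n]_q=1+q+\cdots+q^{n-1}$ and $[n]_q!=[1]_q[2]_q\cdots[n]_q$. For $\sigma=\sigma_1\cdots\sigma_n\in S_n$, $\mathrm{coinv}(\sigma)$ is the number of pairs $1\le i<j\le n$ with $\sigma_i<\sigma_j$. $\sigma_i$ matches $MMP(a,b,0,0)$ if there are at least $a$ indices $j>i$ with $\sigma_j>\sigma_i$ and at least $b$ indices $j<i$ with $\sigma_j>\sigma_i$; $mmp^{(a,b,0,0)}(\sigma)$ is the number of such $i$. $R_n^{(a,b,0,0)}(x,q)=\sum_{\sigma\in S_n}x^{mmp^{(a,b,0,0)}(\sigma)}q^{\mathrm{coinv}(\sigma)}$. -}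

module Defs where

open import Data.Nat using (ℕ; zero; suc; _+_; _*_; _<ᵇ_; _≡ᵇ_)
open import Data.Bool using (Bool; true; false; _∧_; not; if_then_else_)
open import Data.List using (List; []; _∷_; _++_; map; concatMap; length; filterᵇ; foldr; upTo)
open import Data.Nat.ListAction using (sum)
open import Data.Product using (_×_; _,_)

-- Permutations of {0,…,n-1} in one-line notation σ₁⋯σₙ (values shifted
-- down by one; all statistics only compare values, so this is harmless).

words : ℕ → ℕ → List (List ℕ)
words m zero    = [] ∷ []
words m (suc n) = concatMap (λ k → map (k ∷_) (words m n)) (upTo m)

notIn : ℕ → List ℕ → Bool
notIn x []       = true
notIn x (y ∷ ys) = not (x ≡ᵇ y) ∧ notIn x ys

distinct : List ℕ → Bool
distinct []       = true
distinct (x ∷ xs) = notIn x xs ∧ distinct xs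

perms : ℕ → List (List ℕ)
perms n = filterᵇ distinct (words n n)

countGreater : ℕ → List ℕ → ℕ
countGreater v xs = length (filterᵇ (λ y → v <ᵇ y) xs)

coinv : List ℕ → ℕ
coinv []       = 0
coinv (x ∷ xs) = countGreater x xs + coinv xs

_≤ᵇ'_ : ℕ → ℕ → Bool
m ≤ᵇ' n = not (n <ᵇ m)

-- mmp^{(a,b,0,0)}: scan σ keeping the prefix before position i
mmpAux : ℕ → ℕ → List ℕ → List ℕ → ℕ
mmpAux a b pre []       = 0
mmpAux a b pre (x ∷ xs) =
  (if (a ≤ᵇ' countGreater x xs) ∧ (b ≤ᵇ' countGreater x pre) then 1 else 0)
  + mmpAux a b (x ∷ pre) xs

mmp : ℕ → ℕ → List ℕ → ℕ
mmp a b σ = mmpAux a b [] σ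

-- Polynomials in x and q with natural coefficients, as finite lists of
-- monomials (c , i , j) meaning c · x^i · q^j.

Poly : Set
Poly = List (ℕ × ℕ × ℕ)

_⊕_ : Poly → Poly → Poly
p ⊕ r = p ++ r

_⊗_ : Poly → Poly → Poly
p ⊗ r = concatMap (λ { (c , i , j) → map (λ { (d , k , l) → (c * d , i + k , j + l) }) r }) p

one : Poly
one = (1 , 0 , 0) ∷ []

mono : ℕ → ℕ → Poly
mono i j = (1 , i , j) ∷ []

coeff : Poly → ℕ → ℕ → ℕ
coeff p i j = sum (map (λ { (c , k , l) → if (k ≡ᵇ i) ∧ (l ≡ᵇ j) then c else 0 }) p)

_≈P_ : Poly → Poly → Set
p ≈P r = ∀ i j → coeff p i j ≡ coeff r i j
  where open import Relation.Binary.PropositionalEquality using (_≡_)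

prodP : List Poly → Poly
prodP = foldr _⊗_ one

qint : ℕ → Poly
qint n = map (λ k → (1 , 0 , k)) (upTo n)

qfact : ℕ → Poly
qfact zero    = one
qfact (suc n) = qfact n ⊗ qint (suc n)

R : ℕ → ℕ → ℕ → Poly
R n a b = map (λ σ → (1 , mmp a b σ , coinv σ)) (perms n)

factor : ℕ → ℕ → ℕ → Poly
factor a b i = qint a ⊕ ((mono 0 (a + i) ⊗ qint b) ⊕ (mono 1 a ⊗ qint i))

RHS : ℕ → ℕ → ℕ → Poly
RHS a b s = qfact (a + b) ⊗ prodP (map (λ k → factor a b (suc k)) (upTo s))

-- Every permutation of length n + 1 arises uniquely from one of length n by raising all values
-- by one and inserting a new minimum 0 at some position p. The new entry has p larger entries
-- before it and n − p after it, and the statistics of the other entries do not change, so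
-- R_{n+1} = R_n · G_n with G_n = Σ_p x^[a ≤ n − p and b ≤ p] q^(n − p). For n < a + b no
-- position qualifies and G_n = [n+1]_q, which yields [a+b]_q! after a + b steps; for
-- n = a + b + i − 1 the qualifying values of n − p are a, …, a + i − 1, so
-- G_n = [a]_q + q^a x [i]_q + q^(a+i) [b]_q.

module Submission where

open import Defs
open import Data.Nat using (ℕ; zero; suc; _+_; _*_; _∸_; _≤_; _<_; z≤n; s≤s; s≤s⁻¹; z<s; s<s; _≤?_; _<ᵇ_; _≡ᵇ_)
open import Data.Nat.Properties
open import Data.Nat.ListAction using (sum)
open import Data.Nat.Tactic.RingSolver using (solve-∀)
open import Data.Nat.ListAction.Properties using (sum-↭)
open import Data.Bool using (Bool; true; false; _∧_; not; if_then_else_; T; T?)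
open import Data.Bool.Properties using (∧-zeroʳ; T-∧)
open import Data.Unit using (tt)
open import Data.Empty using (⊥-elim)
open import Data.Product using (_×_; _,_; proj₁; proj₂; Σ-syntax)
open import Data.List using (List; []; _∷_; _++_; map; concatMap; length; upTo; applyUpTo; cartesianProductWith)
open import Data.List.Properties using (length-map; map-++; ∷-injective; map-injective; ++-assoc; map-∘; map-upTo; applyUpTo-∷ʳ)
open import Data.List.Relation.Unary.All as All using (All; []; _∷_)
open import Data.List.Relation.Unary.All.Properties using (¬Any⇒All¬) renaming (map⁺ to All-map⁺; map⁻ to All-map⁻)
open import Data.List.Relation.Unary.Any using (here; there)
open import Data.List.Relation.Unary.AllPairs using ([]; _∷_)
open import Data.List.Relation.Unary.Unique.Propositional using (Unique)
import Data.List.Relation.Unary.Unique.Propositional.Properties as Unique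
open import Data.List.Membership.Propositional using (_∈_)
open import Data.List.Membership.DecPropositional _≟_ using (_∈?_)
open import Data.List.Membership.Propositional.Properties
  using (∈-cartesianProductWith⁻; ∈-cartesianProductWith⁺; ∈-upTo⁻; ∈-upTo⁺; ∈-filter⁺; ∈-filter⁻)
open import Data.List.Membership.Propositional.Properties.WithK using (unique∧set⇒bag)
open import Data.List.Relation.Binary.BagAndSetEquality using (∼bag⇒↭)
open import Data.List.Relation.Binary.Permutation.Propositional using (_↭_)
import Data.List.Relation.Binary.Permutation.Propositional.Properties as Perm
open import Function using (_∘_)
open import Function.Bundles using (mk⇔; Equivalence)
open import Relation.Nullary using (yes; no)
open import Relation.Binary.Bundles using (Setoid)
open import Relation.Binary.PropositionalEquality
import Relation.Binary.Reasoning.Setoid as SetoidReasoning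

-- Polynomials up to weighted evaluation

-- Indicator weights recover coefficients, and multiplying by a monomial shifts the weighting,
-- so agreeing under all weightings is a congruence for ⊗ that implies ≈P.

weight : (ℕ → ℕ → ℕ) → ℕ × ℕ × ℕ → ℕ
weight w (c , i , j) = c * w i j

eval : (ℕ → ℕ → ℕ) → Poly → ℕ
eval w p = sum (map (weight w) p)

shift : (ℕ → ℕ → ℕ) → ℕ → ℕ → ℕ → ℕ → ℕ
shift w i j k l = w (i + k) (j + l)

record _≋_ (p r : Poly) : Set where
  constructor mk≋
  field eval-≡ : ∀ w → eval w p ≡ eval w r
open _≋_

infix 4 _≋_

≋-refl : ∀ {p} → p ≋ p
≋-refl = mk≋ λ _ → refl

≋-sym : ∀ {p r} → p ≋ r → r ≋ p
≋-sym e = mk≋ λ w → sym (eval-≡ e w)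

≋-trans : ∀ {p r t} → p ≋ r → r ≋ t → p ≋ t
≋-trans e f = mk≋ λ w → trans (eval-≡ e w) (eval-≡ f w)

≋-setoid : Setoid _ _
≋-setoid = record
  { Carrier = Poly
  ; _≈_ = _≋_
  ; isEquivalence = record { refl = ≋-refl ; sym = ≋-sym ; trans = ≋-trans }
  }

module ≋-Reasoning = SetoidReasoning ≋-setoid

eval-++ : ∀ w p r → eval w (p ++ r) ≡ eval w p + eval w r
eval-++ w []      r = refl
eval-++ w (m ∷ p) r = trans (cong (weight w m +_) (eval-++ w p r)) (sym (+-assoc (weight w m) _ _))

eval-cong : ∀ {w w′} → (∀ i j → w i j ≡ w′ i j) → ∀ p → eval w p ≡ eval w′ p
eval-cong e []                = refl
eval-cong e ((c , i , j) ∷ p) = cong₂ _+_ (cong (c *_) (e i j)) (eval-cong e p)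

⊗-∷ˡ : ∀ m p r → (m ∷ p) ⊗ r ≡ ((m ∷ []) ⊗ r) ++ (p ⊗ r)
⊗-∷ˡ m p r = sym (++-assoc _ [] (p ⊗ r))

eval-monomial-⊗ : ∀ w c i j r → eval w (((c , i , j) ∷ []) ⊗ r) ≡ c * eval (shift w i j) r
eval-monomial-⊗ w c i j []                = sym (*-zeroʳ c)
eval-monomial-⊗ w c i j ((d , k , l) ∷ r) = begin
  c * d * w (i + k) (j + l) + eval w (((c , i , j) ∷ []) ⊗ r)
    ≡⟨ cong₂ _+_ (*-assoc c d _) (eval-monomial-⊗ w c i j r) ⟩
  c * (d * w (i + k) (j + l)) + c * eval (shift w i j) r
    ≡⟨ *-distribˡ-+ c _ _ ⟨
  c * (d * w (i + k) (j + l) + eval (shift w i j) r) ∎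
  where open ≡-Reasoning

eval-⊗ : ∀ w p r → eval w (p ⊗ r) ≡ eval (λ i j → eval (shift w i j) r) p
eval-⊗ w []                r = refl
eval-⊗ w ((c , i , j) ∷ p) r = begin
  eval w (((c , i , j) ∷ p) ⊗ r)
    ≡⟨ cong (eval w) (⊗-∷ˡ (c , i , j) p r) ⟩
  eval w ((((c , i , j) ∷ []) ⊗ r) ++ (p ⊗ r))
    ≡⟨ eval-++ w (((c , i , j) ∷ []) ⊗ r) (p ⊗ r) ⟩
  eval w (((c , i , j) ∷ []) ⊗ r) + eval w (p ⊗ r)
    ≡⟨ cong₂ _+_ (eval-monomial-⊗ w c i j r) (eval-⊗ w p r) ⟩
  c * eval (shift w i j) r + eval (λ i j → eval (shift w i j) r) p ∎
  where open ≡-Reasoning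

⊗-congˡ : ∀ {p p′} r → p ≋ p′ → p ⊗ r ≋ p′ ⊗ r
⊗-congˡ {p} {p′} r e = mk≋ λ w → begin
  eval w (p ⊗ r)                         ≡⟨ eval-⊗ w p r ⟩
  eval (λ i j → eval (shift w i j) r) p  ≡⟨ eval-≡ e _ ⟩
  eval (λ i j → eval (shift w i j) r) p′ ≡⟨ eval-⊗ w p′ r ⟨
  eval w (p′ ⊗ r)                        ∎
  where open ≡-Reasoning

⊗-congʳ : ∀ p {r r′} → r ≋ r′ → p ⊗ r ≋ p ⊗ r′
⊗-congʳ p {r} {r′} e = mk≋ λ w → begin
  eval w (p ⊗ r)                          ≡⟨ eval-⊗ w p r ⟩
  eval (λ i j → eval (shift w i j) r) p   ≡⟨ eval-cong (λ i j → eval-≡ e (shift w i j)) p ⟩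
  eval (λ i j → eval (shift w i j) r′) p  ≡⟨ eval-⊗ w p r′ ⟨
  eval w (p ⊗ r′)                         ∎
  where open ≡-Reasoning

⊗-assoc : ∀ p r t → (p ⊗ r) ⊗ t ≋ p ⊗ (r ⊗ t)
⊗-assoc p r t = mk≋ λ w → begin
  eval w ((p ⊗ r) ⊗ t)
    ≡⟨ eval-⊗ w (p ⊗ r) t ⟩
  eval (λ i j → eval (shift w i j) t) (p ⊗ r)
    ≡⟨ eval-⊗ _ p r ⟩
  eval (λ i j → eval (λ k l → eval (shift w (i + k) (j + l)) t) r) p
    ≡⟨ eval-cong (λ i j → eval-cong (λ k l → eval-cong (λ m n → cong₂ w (+-assoc i k m) (+-assoc j l n)) t) r) p ⟩
  eval (λ i j → eval (λ k l → eval (shift (shift w i j) k l) t) r) p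
    ≡⟨ eval-cong (λ i j → eval-⊗ (shift w i j) r t) p ⟨
  eval (λ i j → eval (shift w i j) (r ⊗ t)) p
    ≡⟨ eval-⊗ w p (r ⊗ t) ⟨
  eval w (p ⊗ (r ⊗ t)) ∎
  where open ≡-Reasoning

⊗-identityˡ : ∀ p → one ⊗ p ≋ p
⊗-identityˡ p = mk≋ λ w → trans (eval-⊗ w one p) (trans (+-identityʳ _) (*-identityˡ _))

⊗-identityʳ : ∀ p → p ⊗ one ≋ p
⊗-identityʳ p = mk≋ λ w → trans (eval-⊗ w p one)
  (eval-cong (λ i j → trans (+-identityʳ _) (trans (*-identityˡ _) (cong₂ w (+-identityʳ i) (+-identityʳ j)))) p)

prodP-∷ʳ : ∀ ps p → prodP (ps ++ p ∷ []) ≋ prodP ps ⊗ p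
prodP-∷ʳ []       p = ≋-trans (⊗-identityʳ p) (≋-sym (⊗-identityˡ p))
prodP-∷ʳ (r ∷ ps) p = ≋-trans (⊗-congʳ r (prodP-∷ʳ ps p)) (≋-sym (⊗-assoc r (prodP ps) p))

indicator : ℕ → ℕ → ℕ → ℕ → ℕ
indicator i j k l = if (k ≡ᵇ i) ∧ (l ≡ᵇ j) then 1 else 0

coeff-eval : ∀ p i j → coeff p i j ≡ eval (indicator i j) p
coeff-eval []                i j = refl
coeff-eval ((c , k , l) ∷ p) i j with (k ≡ᵇ i) ∧ (l ≡ᵇ j)
... | true  = cong₂ _+_ (sym (*-identityʳ c)) (coeff-eval p i j)
... | false = cong₂ _+_ (sym (*-zeroʳ c)) (coeff-eval p i j)

≋⇒≈P : ∀ {p r} → p ≋ r → p ≈P r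
≋⇒≈P {p} {r} e i j = trans (coeff-eval p i j) (trans (eval-≡ e (indicator i j)) (sym (coeff-eval r i j)))

sumBelow : ℕ → (ℕ → ℕ) → ℕ
sumBelow m f = sum (applyUpTo f m)

sumBelow-cong : ∀ m {f g} → (∀ p → p < m → f p ≡ g p) → sumBelow m f ≡ sumBelow m g
sumBelow-cong zero    e = refl
sumBelow-cong (suc m) e = cong₂ _+_ (e 0 z<s) (sumBelow-cong m (λ p p<m → e (suc p) (s<s p<m)))

sumBelow-suc : ∀ m f → sumBelow (suc m) f ≡ sumBelow m f + f m
sumBelow-suc zero    f = +-identityʳ (f 0)
sumBelow-suc (suc m) f = trans (cong (f 0 +_) (sumBelow-suc m (f ∘ suc))) (sym (+-assoc (f 0) _ _))

sumBelow-reverse : ∀ n f → sumBelow (suc n) (λ p → f (n ∸ p)) ≡ sumBelow (suc n) f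
sumBelow-reverse zero    f = refl
sumBelow-reverse (suc n) f = begin
  f (suc n) + sumBelow (suc n) (λ p → f (n ∸ p)) ≡⟨ cong (f (suc n) +_) (sumBelow-reverse n f) ⟩
  f (suc n) + sumBelow (suc n) f                 ≡⟨ +-comm (f (suc n)) _ ⟩
  sumBelow (suc n) f + f (suc n)                 ≡⟨ sumBelow-suc (suc n) f ⟨
  sumBelow (suc (suc n)) f                       ∎
  where open ≡-Reasoning

sumBelow-+ : ∀ m n f → sumBelow (m + n) f ≡ sumBelow m f + sumBelow n (λ p → f (m + p))
sumBelow-+ zero    n f = refl
sumBelow-+ (suc m) n f = trans (cong (f 0 +_) (sumBelow-+ m n (f ∘ suc))) (sym (+-assoc (f 0) _ _))

eval-map-upTo : ∀ w (g : ℕ → ℕ × ℕ × ℕ) m → eval w (map g (upTo m)) ≡ sumBelow m (weight w ∘ g)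
eval-map-upTo w g m = cong sum (trans (sym (map-∘ (upTo m))) (map-upTo (weight w ∘ g) m))

map-upTo-suc : ∀ {A : Set} (f : ℕ → A) k → map f (upTo (suc k)) ≡ map f (upTo k) ++ f k ∷ []
map-upTo-suc f k = begin
  map f (upTo (suc k))          ≡⟨ map-upTo f (suc k) ⟩
  applyUpTo f (suc k)           ≡⟨ applyUpTo-∷ʳ f k ⟨
  applyUpTo f k ++ f k ∷ []     ≡⟨ cong (_++ f k ∷ []) (map-upTo f k) ⟨
  map f (upTo k) ++ f k ∷ []    ∎
  where open ≡-Reasoning

eval-qint : ∀ w m → eval w (qint m) ≡ sumBelow m (λ p → 1 * w 0 p)
eval-qint w m = eval-map-upTo w (λ k → (1 , 0 , k)) m

eval-mono-⊗-qint : ∀ w i j m → eval w (mono i j ⊗ qint m) ≡ sumBelow m (λ p → 1 * w i (j + p))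
eval-mono-⊗-qint w i j m = begin
  eval w (mono i j ⊗ qint m)           ≡⟨ eval-⊗ w (mono i j) (qint m) ⟩
  1 * eval (shift w i j) (qint m) + 0  ≡⟨ trans (+-identityʳ _) (*-identityˡ _) ⟩
  eval (shift w i j) (qint m)          ≡⟨ eval-qint (shift w i j) m ⟩
  sumBelow m (λ p → 1 * w (i + 0) (j + p))
    ≡⟨ sumBelow-cong m (λ p _ → cong (λ u → 1 * w u (j + p)) (+-identityʳ i)) ⟩
  sumBelow m (λ p → 1 * w i (j + p))   ∎
  where open ≡-Reasoning

-- Inserting a new minimum

-- Positions beyond the end give a list without 0; this junk value keeps insertMin injective.
insertZero : ℕ → List ℕ → List ℕ
insertZero zero    xs       = 0 ∷ xs
insertZero (suc p) []       = suc p ∷ []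
insertZero (suc p) (x ∷ xs) = x ∷ insertZero p xs

insertMin : List ℕ → ℕ → List ℕ
insertMin τ p = insertZero p (map suc τ)

bit : Bool → ℕ
bit b = if b then 1 else 0

countGreater-∷ : ∀ v x xs → countGreater v (x ∷ xs) ≡ bit (v <ᵇ x) + countGreater v xs
countGreater-∷ v x xs with v <ᵇ x
... | true  = refl
... | false = refl

countGreater-map-suc : ∀ v xs → countGreater (suc v) (map suc xs) ≡ countGreater v xs
countGreater-map-suc v []       = refl
countGreater-map-suc v (x ∷ xs) = begin
  countGreater (suc v) (suc x ∷ map suc xs)  ≡⟨ countGreater-∷ (suc v) (suc x) (map suc xs) ⟩
  bit (v <ᵇ x) + countGreater (suc v) (map suc xs)
    ≡⟨ cong (bit (v <ᵇ x) +_) (countGreater-map-suc v xs) ⟩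
  bit (v <ᵇ x) + countGreater v xs           ≡⟨ countGreater-∷ v x xs ⟨
  countGreater v (x ∷ xs)                    ∎
  where open ≡-Reasoning

countGreater-zero-map-suc : ∀ xs → countGreater 0 (map suc xs) ≡ length xs
countGreater-zero-map-suc []       = refl
countGreater-zero-map-suc (x ∷ xs) =
  trans (countGreater-∷ 0 (suc x) (map suc xs)) (cong suc (countGreater-zero-map-suc xs))

countGreater-insertMin : ∀ v p τ → p ≤ length τ → countGreater (suc v) (insertMin τ p) ≡ countGreater v τ
countGreater-insertMin v zero    τ       _         =
  trans (countGreater-∷ (suc v) 0 (map suc τ)) (countGreater-map-suc v τ)
countGreater-insertMin v (suc p) (x ∷ τ) (s≤s p≤) = begin
  countGreater (suc v) (suc x ∷ insertMin τ p)        ≡⟨ countGreater-∷ (suc v) (suc x) (insertMin τ p) ⟩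
  bit (v <ᵇ x) + countGreater (suc v) (insertMin τ p) ≡⟨ cong (bit (v <ᵇ x) +_) (countGreater-insertMin v p τ p≤) ⟩
  bit (v <ᵇ x) + countGreater v τ                     ≡⟨ countGreater-∷ v x τ ⟨
  countGreater v (x ∷ τ)                              ∎
  where open ≡-Reasoning

coinv-map-suc : ∀ τ → coinv (map suc τ) ≡ coinv τ
coinv-map-suc []      = refl
coinv-map-suc (x ∷ τ) = cong₂ _+_ (countGreater-map-suc x τ) (coinv-map-suc τ)

coinv-insertMin : ∀ p τ → p ≤ length τ → coinv (insertMin τ p) ≡ coinv τ + (length τ ∸ p)
coinv-insertMin zero    τ       _        =
  trans (cong₂ _+_ (countGreater-zero-map-suc τ) (coinv-map-suc τ)) (+-comm (length τ) (coinv τ))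
coinv-insertMin (suc p) (x ∷ τ) (s≤s p≤) = begin
  countGreater (suc x) (insertMin τ p) + coinv (insertMin τ p)
    ≡⟨ cong₂ _+_ (countGreater-insertMin x p τ p≤) (coinv-insertMin p τ p≤) ⟩
  countGreater x τ + (coinv τ + (length τ ∸ p))
    ≡⟨ +-assoc (countGreater x τ) _ _ ⟨
  countGreater x τ + coinv τ + (length τ ∸ p) ∎
  where open ≡-Reasoning

module _ (a b : ℕ) where

  mmpBit : ℕ → ℕ → ℕ
  mmpBit before after = bit ((a ≤ᵇ' after) ∧ (b ≤ᵇ' before))

  mmpAux-map-suc : ∀ pre pre′ τ → (∀ v → countGreater (suc v) pre′ ≡ countGreater v pre) →
    mmpAux a b pre′ (map suc τ) ≡ mmpAux a b pre τ
  mmpAux-map-suc pre pre′ []      _  = refl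
  mmpAux-map-suc pre pre′ (x ∷ τ) eq =
    cong₂ _+_ (cong₂ mmpBit (eq x) (countGreater-map-suc x τ))
      (mmpAux-map-suc (x ∷ pre) (suc x ∷ pre′) τ λ v → begin
        countGreater (suc v) (suc x ∷ pre′)   ≡⟨ countGreater-∷ (suc v) (suc x) pre′ ⟩
        bit (v <ᵇ x) + countGreater (suc v) pre′ ≡⟨ cong (bit (v <ᵇ x) +_) (eq v) ⟩
        bit (v <ᵇ x) + countGreater v pre     ≡⟨ countGreater-∷ v x pre ⟨
        countGreater v (x ∷ pre)              ∎)
    where open ≡-Reasoning

  mmpAux-insertMin : ∀ pre p τ → p ≤ length τ →
    mmpAux a b (map suc pre) (insertMin τ p) ≡ mmpAux a b pre τ + mmpBit (length pre + p) (length τ ∸ p)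
  mmpAux-insertMin pre zero τ _ = begin
    mmpBit (countGreater 0 (map suc pre)) (countGreater 0 (map suc τ)) + mmpAux a b (0 ∷ map suc pre) (map suc τ)
      ≡⟨ cong₂ _+_ (cong₂ mmpBit (trans (countGreater-zero-map-suc pre) (sym (+-identityʳ _))) (countGreater-zero-map-suc τ))
                   (mmpAux-map-suc pre (0 ∷ map suc pre) τ
                     λ v → trans (countGreater-∷ (suc v) 0 (map suc pre)) (countGreater-map-suc v pre)) ⟩
    mmpBit (length pre + 0) (length τ) + mmpAux a b pre τ
      ≡⟨ +-comm _ (mmpAux a b pre τ) ⟩
    mmpAux a b pre τ + mmpBit (length pre + 0) (length τ) ∎
    where open ≡-Reasoning
  mmpAux-insertMin pre (suc p) (x ∷ τ) (s≤s p≤) = begin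
    mmpBit (countGreater (suc x) (map suc pre)) (countGreater (suc x) (insertMin τ p))
      + mmpAux a b (map suc (x ∷ pre)) (insertMin τ p)
      ≡⟨ cong₂ _+_ (cong₂ mmpBit (countGreater-map-suc x pre) (countGreater-insertMin x p τ p≤))
                   (mmpAux-insertMin (x ∷ pre) p τ p≤) ⟩
    mmpBit (countGreater x pre) (countGreater x τ) + (mmpAux a b (x ∷ pre) τ + mmpBit (suc (length pre) + p) (length τ ∸ p))
      ≡⟨ +-assoc (mmpBit (countGreater x pre) (countGreater x τ)) (mmpAux a b (x ∷ pre) τ) _ ⟨
    mmpAux a b pre (x ∷ τ) + mmpBit (suc (length pre) + p) (length τ ∸ p)
      ≡⟨ cong (λ l → mmpAux a b pre (x ∷ τ) + mmpBit l (length τ ∸ p)) (sym (+-suc (length pre) p)) ⟩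
    mmpAux a b pre (x ∷ τ) + mmpBit (length pre + suc p) (length (x ∷ τ) ∸ suc p) ∎
    where open ≡-Reasoning

-- Two enumerations of the permutations

IsPerm : ℕ → List ℕ → Set
IsPerm n σ = length σ ≡ n × All (_< n) σ × Unique σ

notIn⇒All≢ : ∀ x ys → T (notIn x ys) → All (x ≢_) ys
notIn⇒All≢ x []       _    = []
notIn⇒All≢ x (y ∷ ys) x∉ with x ≡ᵇ y in eq
... | false = (λ { refl → subst T eq (≡⇒≡ᵇ x x refl) }) ∷ notIn⇒All≢ x ys x∉

All≢⇒notIn : ∀ x ys → All (x ≢_) ys → T (notIn x ys)
All≢⇒notIn x []       _            = tt
All≢⇒notIn x (y ∷ ys) (x≢y ∷ x∉) with x ≡ᵇ y in eq
... | true  = ⊥-elim (x≢y (≡ᵇ⇒≡ x y (subst T (sym eq) tt)))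
... | false = All≢⇒notIn x ys x∉

distinct⇒Unique : ∀ xs → T (distinct xs) → Unique xs
distinct⇒Unique []       _ = []
distinct⇒Unique (x ∷ xs) d with x∉ , d′ ← Equivalence.to T-∧ d = notIn⇒All≢ x xs x∉ ∷ distinct⇒Unique xs d′

Unique⇒distinct : ∀ xs → Unique xs → T (distinct xs)
Unique⇒distinct []       _        = tt
Unique⇒distinct (x ∷ xs) (x∉ ∷ u) = Equivalence.from T-∧ (All≢⇒notIn x xs x∉ , Unique⇒distinct xs u)

words-suc : ∀ m n → words m (suc n) ≡ cartesianProductWith _∷_ (upTo m) (words m n)
words-suc m n = concatMap≡ (upTo m)
  where
    concatMap≡ : ∀ ks → concatMap (λ k → map (k ∷_) (words m n)) ks ≡ cartesianProductWith _∷_ ks (words m n)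
    concatMap≡ []       = refl
    concatMap≡ (k ∷ ks) = cong (map (k ∷_) (words m n) ++_) (concatMap≡ ks)

∈-words⁻ : ∀ m n {σ} → σ ∈ words m n → length σ ≡ n × All (_< m) σ
∈-words⁻ m zero    (here refl) = refl , []
∈-words⁻ m (suc n) {σ} σ∈
  with k , τ , k∈ , τ∈ , refl ← ∈-cartesianProductWith⁻ _∷_ (upTo m) (words m n) (subst (σ ∈_) (words-suc m n) σ∈)
  with |τ| , τ< ← ∈-words⁻ m n τ∈
  = cong suc |τ| , ∈-upTo⁻ k∈ ∷ τ<

∈-words⁺ : ∀ m n σ → length σ ≡ n → All (_< m) σ → σ ∈ words m n
∈-words⁺ m zero    []      refl _          = here refl
∈-words⁺ m (suc n) (k ∷ τ) refl (k< ∷ τ<) = subst ((k ∷ τ) ∈_) (sym (words-suc m n))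
  (∈-cartesianProductWith⁺ _∷_ (∈-upTo⁺ k<) (∈-words⁺ m n τ refl τ<))

words-Unique : ∀ m n → Unique (words m n)
words-Unique m zero    = [] ∷ []
words-Unique m (suc n) = subst Unique (sym (words-suc m n))
  (Unique.cartesianProductWith⁺ _∷_ ∷-injective (Unique.upTo⁺ m) (words-Unique m n))

∈-perms⁻ : ∀ n {σ} → σ ∈ perms n → IsPerm n σ
∈-perms⁻ n σ∈ with σ∈words , d ← ∈-filter⁻ (T? ∘ distinct) {xs = words n n} σ∈ =
  proj₁ (∈-words⁻ n n σ∈words) , proj₂ (∈-words⁻ n n σ∈words) , distinct⇒Unique _ d

∈-perms⁺ : ∀ n σ → IsPerm n σ → σ ∈ perms n
∈-perms⁺ n σ (|σ| , σ< , u) = ∈-filter⁺ (T? ∘ distinct) (∈-words⁺ n n σ |σ| σ<) (Unique⇒distinct σ u)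

perms-Unique : ∀ n → Unique (perms n)
perms-Unique n = Unique.filter⁺ (T? ∘ distinct) (words-Unique n n)

length-insertMin : ∀ τ p → length (insertMin τ p) ≡ suc (length τ)
length-insertMin τ       zero    = cong suc (length-map suc τ)
length-insertMin []      (suc p) = refl
length-insertMin (x ∷ τ) (suc p) = cong suc (length-insertMin τ p)

All-insertMin⁺ : ∀ {P : ℕ → Set} τ p → P 0 → All (P ∘ suc) τ → p ≤ length τ → All P (insertMin τ p)
All-insertMin⁺ τ       zero    P0 Pτ _        = P0 ∷ All-map⁺ Pτ
All-insertMin⁺ (x ∷ τ) (suc p) P0 (Px ∷ Pτ) (s≤s p≤) = Px ∷ All-insertMin⁺ τ p P0 Pτ p≤

All-insertMin⁻ : ∀ {P : ℕ → Set} τ p → p ≤ length τ → All P (insertMin τ p) → All (P ∘ suc) τ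
All-insertMin⁻ τ       zero    _        (_ ∷ Pτ)  = All-map⁻ Pτ
All-insertMin⁻ (x ∷ τ) (suc p) (s≤s p≤) (Px ∷ Pτ) = Px ∷ All-insertMin⁻ τ p p≤ Pτ

Unique-insertMin⁺ : ∀ τ p → Unique τ → p ≤ length τ → Unique (insertMin τ p)
Unique-insertMin⁺ τ       zero    u          _        =
  All-map⁺ (All.universal (λ _ ()) τ) ∷ Unique.map⁺ suc-injective u
Unique-insertMin⁺ (x ∷ τ) (suc p) (x∉ ∷ u) (s≤s p≤) =
  All-insertMin⁺ τ p (λ ()) (All.map (λ x≢y → x≢y ∘ suc-injective) x∉) p≤ ∷ Unique-insertMin⁺ τ p u p≤

Unique-insertMin⁻ : ∀ τ p → p ≤ length τ → Unique (insertMin τ p) → Unique τ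
Unique-insertMin⁻ τ       zero    _        (_ ∷ u)  = Unique.map⁻ u
Unique-insertMin⁻ (x ∷ τ) (suc p) (s≤s p≤) (x∉ ∷ u) =
  All.map (λ x≢y → x≢y ∘ cong suc) (All-insertMin⁻ τ p p≤ x∉) ∷ Unique-insertMin⁻ τ p p≤ u

insertMin-injective : ∀ {τ τ′ p p′} → insertMin τ p ≡ insertMin τ′ p′ → τ ≡ τ′ × p ≡ p′
insertMin-injective {τ}     {τ′}     {zero}  {zero}   eq   = map-injective suc-injective (proj₂ (∷-injective eq)) , refl
insertMin-injective {τ}     {[]}     {zero}  {suc p′} ()
insertMin-injective {τ}     {_ ∷ _}  {zero}  {suc p′} ()
insertMin-injective {[]}    {_}      {suc p} {zero}   ()
insertMin-injective {_ ∷ _} {_}      {suc p} {zero}   ()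
insertMin-injective {[]}    {[]}     {suc p} {suc p′} refl = refl , refl
insertMin-injective {[]}    {y ∷ τ′} {suc p} {suc p′} eq   =
  ⊥-elim (0≢1+n (trans (cong length (proj₂ (∷-injective eq))) (length-insertMin τ′ p′)))
insertMin-injective {x ∷ τ} {[]}     {suc p} {suc p′} eq   =
  ⊥-elim (0≢1+n (trans (cong length (sym (proj₂ (∷-injective eq)))) (length-insertMin τ p)))
insertMin-injective {x ∷ τ} {y ∷ τ′} {suc p} {suc p′} eq
  with x≡y ← suc-injective (proj₁ (∷-injective eq))
  with refl , refl ← insertMin-injective {τ} {τ′} {p} {p′} (proj₂ (∷-injective eq))
  = cong (_∷ τ) x≡y , refl

≢0⇒map-suc : ∀ xs → All (0 ≢_) xs → Σ[ ys ∈ List ℕ ] xs ≡ map suc ys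
≢0⇒map-suc []           _              = [] , refl
≢0⇒map-suc (zero  ∷ xs) (0≢0 ∷ _)      = ⊥-elim (0≢0 refl)
≢0⇒map-suc (suc x ∷ xs) (_ ∷ xs≢0)
  with ys , refl ← ≢0⇒map-suc xs xs≢0 = x ∷ ys , refl

0∈⇒insertMin : ∀ σ → Unique σ → 0 ∈ σ → Σ[ τ ∈ List ℕ ] Σ[ p ∈ ℕ ] p ≤ length τ × σ ≡ insertMin τ p
0∈⇒insertMin (zero ∷ σ) (0∉ ∷ _) (here refl)
  with τ , refl ← ≢0⇒map-suc σ 0∉ = τ , 0 , z≤n , refl
0∈⇒insertMin (zero ∷ σ) (0∉ ∷ _) (there 0∈) = ⊥-elim (All.lookup 0∉ 0∈ refl)
0∈⇒insertMin (suc x ∷ σ) (_ ∷ u) (there 0∈)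
  with τ , p , p≤ , refl ← 0∈⇒insertMin σ u 0∈ = x ∷ τ , suc p , s≤s p≤ , refl

data ZeroView : List ℕ → Set where
  inserted : ∀ τ p → p ≤ length τ → ZeroView (insertMin τ p)
  raised   : ∀ τ → ZeroView (map suc τ)

zeroView : ∀ σ → Unique σ → ZeroView σ
zeroView σ u with 0 ∈? σ
... | yes 0∈ with τ , p , p≤ , refl ← 0∈⇒insertMin σ u 0∈ = inserted τ p p≤
... | no  0∉ with τ , refl ← ≢0⇒map-suc σ (¬Any⇒All¬ σ 0∉) = raised τ

Unique⇒length≤ : ∀ m σ → Unique σ → All (_< m) σ → length σ ≤ m
Unique⇒length≤ zero    []      _ _        = z≤n
Unique⇒length≤ zero    (_ ∷ _) _ (() ∷ _)
Unique⇒length≤ (suc m) σ       u σ< with zeroView σ u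
... | inserted τ p p≤ = subst (_≤ suc m) (sym (length-insertMin τ p))
  (s≤s (Unique⇒length≤ m τ (Unique-insertMin⁻ τ p p≤ u) (All.map s≤s⁻¹ (All-insertMin⁻ τ p p≤ σ<))))
... | raised τ = m≤n⇒m≤1+n (subst (_≤ m) (sym (length-map suc τ))
  (Unique⇒length≤ m τ (Unique.map⁻ u) (All.map s≤s⁻¹ (All-map⁻ σ<))))

permsByInsertion : ℕ → List (List ℕ)
permsByInsertion zero    = [] ∷ []
permsByInsertion (suc n) = cartesianProductWith insertMin (permsByInsertion n) (upTo (suc n))

∈-permsByInsertion⁻ : ∀ n {σ} → σ ∈ permsByInsertion n → IsPerm n σ
∈-permsByInsertion⁻ zero    (here refl) = refl , [] , []
∈-permsByInsertion⁻ (suc n) σ∈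
  with τ , p , τ∈ , p∈ , refl ← ∈-cartesianProductWith⁻ insertMin (permsByInsertion n) (upTo (suc n)) σ∈
  with |τ| , τ< , u ← ∈-permsByInsertion⁻ n τ∈ =
    trans (length-insertMin τ p) (cong suc |τ|) ,
    All-insertMin⁺ τ p z<s (All.map s<s τ<) p≤ ,
    Unique-insertMin⁺ τ p u p≤
  where
    p≤ : p ≤ length τ
    p≤ = subst (p ≤_) (sym |τ|) (s≤s⁻¹ (∈-upTo⁻ p∈))

∈-permsByInsertion⁺ : ∀ n σ → IsPerm n σ → σ ∈ permsByInsertion n
∈-permsByInsertion⁺ zero    [] _ = here refl
∈-permsByInsertion⁺ (suc n) σ (|σ| , σ< , u) with zeroView σ u
... | raised τ = ⊥-elim (1+n≰n (subst (_≤ n) (trans (sym (length-map suc τ)) |σ|)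
  (Unique⇒length≤ n τ (Unique.map⁻ u) (All.map s≤s⁻¹ (All-map⁻ σ<)))))
... | inserted τ p p≤ = ∈-cartesianProductWith⁺ insertMin
  (∈-permsByInsertion⁺ n τ (|τ| , All.map s≤s⁻¹ (All-insertMin⁻ τ p p≤ σ<) , Unique-insertMin⁻ τ p p≤ u))
  (∈-upTo⁺ (s≤s (subst (p ≤_) |τ| p≤)))
  where
    |τ| : length τ ≡ n
    |τ| = suc-injective (trans (sym (length-insertMin τ p)) |σ|)

permsByInsertion-Unique : ∀ n → Unique (permsByInsertion n)
permsByInsertion-Unique zero    = [] ∷ []
permsByInsertion-Unique (suc n) =
  Unique.cartesianProductWith⁺ insertMin insertMin-injective (permsByInsertion-Unique n) (Unique.upTo⁺ (suc n))

perms↭permsByInsertion : ∀ n → perms n ↭ permsByInsertion n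
perms↭permsByInsertion n = ∼bag⇒↭ (unique∧set⇒bag (perms-Unique n) (permsByInsertion-Unique n)
  (λ {σ} → mk⇔ (∈-permsByInsertion⁺ n σ ∘ ∈-perms⁻ n) (∈-perms⁺ n σ ∘ ∈-permsByInsertion⁻ n)))

module _ (a b : ℕ) where

  term : List ℕ → ℕ × ℕ × ℕ
  term σ = (1 , mmp a b σ , coinv σ)

  R-byInsertion : ℕ → Poly
  R-byInsertion n = map term (permsByInsertion n)

  insertionTerm : ℕ → ℕ → ℕ × ℕ × ℕ
  insertionTerm n p = (1 , mmpBit a b p (n ∸ p) , n ∸ p)

  insertionFactor : ℕ → Poly
  insertionFactor n = map (insertionTerm n) (upTo (suc n))

  terms-insertMin : ∀ τ ps → All (_≤ length τ) ps →
    map term (map (insertMin τ) ps) ≡ (term τ ∷ []) ⊗ map (insertionTerm (length τ)) ps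
  terms-insertMin τ []       []          = refl
  terms-insertMin τ (p ∷ ps) (p≤ ∷ ps≤) = cong₂ _∷_
    (cong₂ (λ i j → (1 , i , j)) (mmpAux-insertMin a b [] p τ p≤) (coinv-insertMin p τ p≤))
    (terms-insertMin τ ps ps≤)

  terms-cartesianProduct : ∀ n L → All (λ τ → length τ ≡ n) L →
    map term (cartesianProductWith insertMin L (upTo (suc n))) ≡ map term L ⊗ insertionFactor n
  terms-cartesianProduct n []      []            = refl
  terms-cartesianProduct n (τ ∷ L) (refl ∷ L-len) = begin
    map term (map (insertMin τ) U ++ cartesianProductWith insertMin L U)
      ≡⟨ map-++ term (map (insertMin τ) U) _ ⟩
    map term (map (insertMin τ) U) ++ map term (cartesianProductWith insertMin L U)
      ≡⟨ cong₂ _++_ (terms-insertMin τ U (All.tabulate (s≤s⁻¹ ∘ ∈-upTo⁻))) (terms-cartesianProduct n L L-len) ⟩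
    ((term τ ∷ []) ⊗ insertionFactor n) ++ (map term L ⊗ insertionFactor n)
      ≡⟨ ⊗-∷ˡ (term τ) (map term L) (insertionFactor n) ⟨
    (term τ ∷ map term L) ⊗ insertionFactor n ∎
    where
      open ≡-Reasoning
      U : List ℕ
      U = upTo (suc n)

  R-byInsertion-suc : ∀ n → R-byInsertion (suc n) ≡ R-byInsertion n ⊗ insertionFactor n
  R-byInsertion-suc n =
    terms-cartesianProduct n (permsByInsertion n) (All.tabulate (proj₁ ∘ ∈-permsByInsertion⁻ n))

<ᵇ-true : ∀ {m n} → m < n → (m <ᵇ n) ≡ true
<ᵇ-true {zero}  {suc n} _         = refl
<ᵇ-true {suc m} {suc n} (s<s m<n) = <ᵇ-true m<n

<ᵇ-false : ∀ {m n} → n ≤ m → (m <ᵇ n) ≡ false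
<ᵇ-false {m}     {zero}  _         = refl
<ᵇ-false {suc m} {suc n} (s≤s n≤m) = <ᵇ-false n≤m

module _ (a b : ℕ) where

  mmpBit-after< : ∀ {before after} → after < a → mmpBit a b before after ≡ 0
  mmpBit-after< {before} after<a = cong (λ t → bit (not t ∧ (b ≤ᵇ' before))) (<ᵇ-true after<a)

  mmpBit-before< : ∀ {before after} → before < b → mmpBit a b before after ≡ 0
  mmpBit-before< {after = after} before<b =
    trans (cong (λ t → bit ((a ≤ᵇ' after) ∧ not t)) (<ᵇ-true before<b)) (cong bit (∧-zeroʳ (a ≤ᵇ' after)))

  mmpBit-≤ : ∀ {before after} → a ≤ after → b ≤ before → mmpBit a b before after ≡ 1
  mmpBit-≤ a≤after b≤before =
    cong₂ (λ s t → bit (not s ∧ not t)) (<ᵇ-false a≤after) (<ᵇ-false b≤before)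

  eval-insertionFactor : ∀ w n →
    eval w (insertionFactor a b n) ≡ sumBelow (suc n) (λ j → 1 * w (mmpBit a b (n ∸ j) j) j)
  eval-insertionFactor w n = begin
    eval w (insertionFactor a b n)
      ≡⟨ eval-map-upTo w (insertionTerm a b n) (suc n) ⟩
    sumBelow (suc n) (λ p → 1 * w (mmpBit a b p (n ∸ p)) (n ∸ p))
      ≡⟨ sumBelow-cong (suc n) (λ p p≤n →
           cong (λ q → 1 * w (mmpBit a b q (n ∸ p)) (n ∸ p)) (sym (m∸[m∸n]≡n (s≤s⁻¹ p≤n)))) ⟩
    sumBelow (suc n) (λ p → term-at (n ∸ p))
      ≡⟨ sumBelow-reverse n term-at ⟩
    sumBelow (suc n) term-at ∎
    where
      open ≡-Reasoning
      term-at : ℕ → ℕ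
      term-at j = 1 * w (mmpBit a b (n ∸ j) j) j

  insertionFactor-below : ∀ {n} → n < a + b → insertionFactor a b n ≋ qint (suc n)
  insertionFactor-below {n} n<a+b = mk≋ λ w → begin
    eval w (insertionFactor a b n)
      ≡⟨ eval-insertionFactor w n ⟩
    sumBelow (suc n) (λ j → 1 * w (mmpBit a b (n ∸ j) j) j)
      ≡⟨ sumBelow-cong (suc n) (λ j j≤n → cong (λ x → 1 * w x j) (unmatched j (s≤s⁻¹ j≤n))) ⟩
    sumBelow (suc n) (λ j → 1 * w 0 j)
      ≡⟨ eval-qint w (suc n) ⟨
    eval w (qint (suc n)) ∎
    where
      open ≡-Reasoning
      unmatched : ∀ j → j ≤ n → mmpBit a b (n ∸ j) j ≡ 0
      unmatched j j≤n with a ≤? j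
      ... | no  a≰j = mmpBit-after< (≰⇒> a≰j)
      ... | yes a≤j = mmpBit-before< (subst (n ∸ j <_) (m+n∸m≡n j b)
            (∸-monoˡ-< (<-≤-trans n<a+b (+-monoˡ-≤ b a≤j)) j≤n))

  eval-factor : ∀ w i → eval w (factor a b i) ≡
    sumBelow a (λ j → 1 * w 0 j) + (sumBelow b (λ p → 1 * w 0 (a + i + p)) + sumBelow i (λ p → 1 * w 1 (a + p)))
  eval-factor w i = begin
    eval w (qint a ++ ((mono 0 (a + i) ⊗ qint b) ++ (mono 1 a ⊗ qint i)))
      ≡⟨ eval-++ w (qint a) _ ⟩
    eval w (qint a) + eval w ((mono 0 (a + i) ⊗ qint b) ++ (mono 1 a ⊗ qint i))
      ≡⟨ cong (eval w (qint a) +_) (eval-++ w (mono 0 (a + i) ⊗ qint b) _) ⟩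
    eval w (qint a) + (eval w (mono 0 (a + i) ⊗ qint b) + eval w (mono 1 a ⊗ qint i))
      ≡⟨ cong₂ _+_ (eval-qint w a) (cong₂ _+_ (eval-mono-⊗-qint w 0 (a + i) b) (eval-mono-⊗-qint w 1 a i)) ⟩
    sumBelow a (λ j → 1 * w 0 j) + (sumBelow b (λ p → 1 * w 0 (a + i + p)) + sumBelow i (λ p → 1 * w 1 (a + p))) ∎
    where open ≡-Reasoning

  -- For n = a + b + k the entry inserted with j larger entries after it matches
  -- exactly when a ≤ j ≤ a + k.
  insertionFactor-above : ∀ k → insertionFactor a b (a + b + k) ≋ factor a b (suc k)
  insertionFactor-above k = mk≋ λ w → begin
    eval w (insertionFactor a b n)
      ≡⟨ eval-insertionFactor w n ⟩
    sumBelow (suc n) (term-at w)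
      ≡⟨ cong (λ m → sumBelow m (term-at w)) (length-split a b k) ⟩
    sumBelow (a + (suc k + b)) (term-at w)
      ≡⟨ sumBelow-+ a (suc k + b) (term-at w) ⟩
    sumBelow a (term-at w) + sumBelow (suc k + b) (λ p → term-at w (a + p))
      ≡⟨ cong (sumBelow a (term-at w) +_) (sumBelow-+ (suc k) b (λ p → term-at w (a + p))) ⟩
    sumBelow a (term-at w) + (sumBelow (suc k) (λ p → term-at w (a + p)) + sumBelow b (λ p → term-at w (a + (suc k + p))))
      ≡⟨ cong₂ _+_ (low w) (cong₂ _+_ (middle w) (high w)) ⟩
    sumBelow a (λ j → 1 * w 0 j) + (sumBelow (suc k) (λ p → 1 * w 1 (a + p)) + sumBelow b (λ p → 1 * w 0 (a + suc k + p)))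
      ≡⟨ cong (sumBelow a (λ j → 1 * w 0 j) +_) (+-comm (sumBelow (suc k) (λ p → 1 * w 1 (a + p))) _) ⟩
    sumBelow a (λ j → 1 * w 0 j) + (sumBelow b (λ p → 1 * w 0 (a + suc k + p)) + sumBelow (suc k) (λ p → 1 * w 1 (a + p)))
      ≡⟨ eval-factor w (suc k) ⟨
    eval w (factor a b (suc k)) ∎
    where
      open ≡-Reasoning
      n : ℕ
      n = a + b + k

      term-at : (ℕ → ℕ → ℕ) → ℕ → ℕ
      term-at w j = 1 * w (mmpBit a b (n ∸ j) j) j

      length-split : ∀ x y z → suc (x + y + z) ≡ x + (suc z + y)
      length-split = solve-∀

      n∸[a+p] : ∀ p → n ∸ (a + p) ≡ (b + k) ∸ p
      n∸[a+p] p = trans (cong (_∸ (a + p)) (+-assoc a b k)) ([m+n]∸[m+o]≡n∸o a (b + k) p)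

      low : ∀ w → sumBelow a (term-at w) ≡ sumBelow a (λ j → 1 * w 0 j)
      low w = sumBelow-cong a (λ j j<a → cong (λ x → 1 * w x j) (mmpBit-after< j<a))

      middle : ∀ w → sumBelow (suc k) (λ p → term-at w (a + p)) ≡ sumBelow (suc k) (λ p → 1 * w 1 (a + p))
      middle w = sumBelow-cong (suc k) λ p p<1+k → cong (λ x → 1 * w x (a + p)) (mmpBit-≤ (m≤m+n a p)
        (subst (b ≤_) (sym (trans (n∸[a+p] p) (+-∸-assoc b (s≤s⁻¹ p<1+k)))) (m≤m+n b (k ∸ p))))

      high : ∀ w → sumBelow b (λ p → term-at w (a + (suc k + p))) ≡ sumBelow b (λ p → 1 * w 0 (a + suc k + p))
      high w = sumBelow-cong b λ p p<b → cong₂ (λ x y → 1 * w x y)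
        (mmpBit-before< (subst (_< b) (sym (begin
            n ∸ (a + (suc k + p))   ≡⟨ n∸[a+p] (suc k + p) ⟩
            (b + k) ∸ suc (k + p)   ≡⟨ cong₂ _∸_ (+-comm b k) (sym (+-suc k p)) ⟩
            (k + b) ∸ (k + suc p)   ≡⟨ [m+n]∸[m+o]≡n∸o k b (suc p) ⟩
            b ∸ suc p               ∎))
          (∸-monoʳ-< z<s p<b)))
        (sym (+-assoc a (suc k) p))

module _ (a b : ℕ) where
  open ≋-Reasoning

  R≋R-byInsertion : ∀ n → R n a b ≋ R-byInsertion a b n
  R≋R-byInsertion n = mk≋ λ w → sum-↭ (Perm.map⁺ (weight w) (Perm.map⁺ (term a b) (perms↭permsByInsertion n)))

  R-byInsertion-below : ∀ m → m ≤ a + b → R-byInsertion a b m ≋ qfact m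
  R-byInsertion-below zero    _       = ≋-refl
  R-byInsertion-below (suc m) m<a+b = begin
    R-byInsertion a b (suc m)                ≡⟨ R-byInsertion-suc a b m ⟩
    R-byInsertion a b m ⊗ insertionFactor a b m
      ≈⟨ ⊗-congˡ (insertionFactor a b m) (R-byInsertion-below m (<⇒≤ m<a+b)) ⟩
    qfact m ⊗ insertionFactor a b m          ≈⟨ ⊗-congʳ (qfact m) (insertionFactor-below a b m<a+b) ⟩
    qfact m ⊗ qint (suc m)                   ∎

  R-byInsertion-above : ∀ s → R-byInsertion a b (a + b + s) ≋ RHS a b s
  R-byInsertion-above zero = begin
    R-byInsertion a b (a + b + 0)   ≡⟨ cong (R-byInsertion a b) (+-identityʳ (a + b)) ⟩
    R-byInsertion a b (a + b)       ≈⟨ R-byInsertion-below (a + b) ≤-refl ⟩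
    qfact (a + b)                   ≈⟨ ⊗-identityʳ (qfact (a + b)) ⟨
    qfact (a + b) ⊗ one             ∎
  R-byInsertion-above (suc k) = begin
    R-byInsertion a b (a + b + suc k)
      ≡⟨ cong (R-byInsertion a b) (+-suc (a + b) k) ⟩
    R-byInsertion a b (suc (a + b + k))
      ≡⟨ R-byInsertion-suc a b (a + b + k) ⟩
    R-byInsertion a b (a + b + k) ⊗ insertionFactor a b (a + b + k)
      ≈⟨ ⊗-congˡ (insertionFactor a b (a + b + k)) (R-byInsertion-above k) ⟩
    (qfact (a + b) ⊗ prodP Fs) ⊗ insertionFactor a b (a + b + k)
      ≈⟨ ⊗-congʳ (qfact (a + b) ⊗ prodP Fs) (insertionFactor-above a b k) ⟩
    (qfact (a + b) ⊗ prodP Fs) ⊗ factor a b (suc k)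
      ≈⟨ ⊗-assoc (qfact (a + b)) (prodP Fs) (factor a b (suc k)) ⟩
    qfact (a + b) ⊗ (prodP Fs ⊗ factor a b (suc k))
      ≈⟨ ⊗-congʳ (qfact (a + b)) (prodP-∷ʳ Fs (factor a b (suc k))) ⟨
    qfact (a + b) ⊗ prodP (Fs ++ factor a b (suc k) ∷ [])
      ≡⟨ cong (λ ps → qfact (a + b) ⊗ prodP ps) (map-upTo-suc (λ i → factor a b (suc i)) k) ⟨
    RHS a b (suc k) ∎
    where
      Fs : List Poly
      Fs = map (λ i → factor a b (suc i)) (upTo k)

-- The identity holds for all a, b and s.
mainTheorem8 : (a b : ℕ) → 1 ≤ a → 1 ≤ b → (s : ℕ) → 1 ≤ s →
    R (a + b + s) a b ≈P RHS a b s
mainTheorem8 a b _ _ s _ = ≋⇒≈P (≋-trans (R≋R-byInsertion a b (a + b + s)) (R-byInsertion-above a b s))
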